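{- Let $p$ be a prime, $r \geq 1$ an integer, and $1 \leq a_1 \leq \dots \leq a_{r-1} < a_r$ integers, and let $G \simeq C_{p^{a_1}} \oplus \cdots \oplus C_{p^{a_r}}$. Then for every integer $\delta$ with $0 \leq \delta \leq \mathsf{d}(G)-1$, $$\Gamma_{\delta}(G)=\max\left(0,(p^{a_r}-1)-\delta-\left\lfloor \frac{\delta}{p-1} \right\rfloor\right).$$
   Context: $C_n$ denotes the cyclic group of order $n$. A sequence in a finite abelian group $G$ is a finite unordered list of elements of $G$ with repetition allowed; its length is the number of terms counted with multiplicity. A sequence is zero-sumfree if no nonempty subsequence has sum $0$. $\mathsf{d}(G)$ denotes the maximal length of a zero-sumfree sequence in $G$. An element has maximal order if its order equals the exponent $\exp(G)$. For an integer $0 \le \delta \le \mathsf{d}(G)-1$, $\Gamma_\delta(G)$ is the minimum, over all zero-sumfree sequences $S$ in $G$ with $|S| \geq \mathsf{d}(G)-\delta$, of the number of terms of $S$ (with multiplicity) of maximal order. -}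

module Defs where

open import Data.Nat using (ℕ; zero; suc; _+_; _*_; _∸_; _≤_; _<_)
open import Data.Nat.Divisibility using (_∣_)
open import Data.Fin using (Fin; zero; suc)
open import Data.List using (List; []; _∷_; length; map)
open import Data.Nat.ListAction using (sum)
open import Data.List.Relation.Binary.Sublist.Propositional using (_⊆_)
open import Data.Product using (Σ; _×_; ∃)
open import Relation.Nullary using (¬_)
open import Relation.Binary.PropositionalEquality using (_≡_; _≢_)

-- The group G = C_{m 0} ⊕ ... ⊕ C_{m (k-1)} is modelled by moduli m : Fin k → ℕ.
-- An element is given by a representative x : Fin k → ℕ (component i read mod m i).
Moduli : ℕ → Set
Moduli k = Fin k → ℕ

Elem : ℕ → Set
Elem k = Fin k → ℕ

IsZero : ∀ {k} → Moduli k → Elem k → Set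
IsZero m x = ∀ i → m i ∣ x i

_·_ : ∀ {k} → ℕ → Elem k → Elem k
(n · x) i = n * x i

σ : ∀ {k} → List (Elem k) → Elem k
σ S i = sum (map (λ g → g i) S)

ZeroSumFree : ∀ {k} → Moduli k → List (Elem k) → Set
ZeroSumFree m S = ∀ T → T ⊆ S → T ≢ [] → ¬ IsZero m (σ T)

IsDavenport : ∀ {k} → Moduli k → ℕ → Set
IsDavenport m n =
  (Σ (List (Elem _)) λ S → ZeroSumFree m S × length S ≡ n)
  × (∀ S → ZeroSumFree m S → length S ≤ n)

IsOrder : ∀ {k} → Moduli k → Elem k → ℕ → Set
IsOrder m g n = 0 < n × IsZero m (n · g) × (∀ j → 0 < j → j < n → ¬ IsZero m (j · g))

IsExponent : ∀ {k} → Moduli k → ℕ → Set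
IsExponent m n = 0 < n × (∀ g → IsZero m (n · g))
  × (∀ j → 0 < j → j < n → ¬ (∀ g → IsZero m (j · g)))

MaxOrder : ∀ {k} → Moduli k → Elem k → Set
MaxOrder m g = ∃ λ e → IsExponent m e × IsOrder m g e

data CountMax {k} (m : Moduli k) : List (Elem k) → ℕ → Set where
  cnil  : CountMax m [] 0
  cyes  : ∀ {g S c} → MaxOrder m g → CountMax m S c → CountMax m (g ∷ S) (suc c)
  cno   : ∀ {g S c} → ¬ MaxOrder m g → CountMax m S c → CountMax m (g ∷ S) c

IsGamma : ∀ {k} → Moduli k → (d δ γ : ℕ) → Set
IsGamma m d δ γ =
  (Σ (List (Elem _)) λ S → ZeroSumFree m S × d ∸ δ ≤ length S × CountMax m S γ)
  × (∀ S c → ZeroSumFree m S → d ∸ δ ≤ length S → CountMax m S c → γ ≤ c)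

snoc : ∀ {n} → (Fin n → ℕ) → ℕ → Fin (suc n) → ℕ
snoc {zero} f b zero = b
snoc {suc n} f b zero = f zero
snoc {suc n} f b (suc i) = snoc (λ j → f (suc j)) b i

-- For a zero-sumfree sequence S the iterated difference Δ_S 𝟙₀ of the indicator of 0 ∈ G is ±1 at 0,
-- hence nonzero modulo p. Modulo p, Frobenius gives Δ_{p^e u} = (Δ_u)^{p^e}, so Δ_s lies in the
-- translation-invariant span of the Δ_{e_j}^w for every p-power w dividing s_j, while Δ_{e_j}^{m_j}
-- kills functions of period m_j. Expanding Δ_S 𝟙₀ this way, it is nonzero only if every term s can
-- be placed at a coordinate j_s with Σ_{j_s = j} w(s, j) < m_j for all j. Take w = p for a term
-- placed at the largest factor C_{p^b} whose entry there is divisible by p, and w = 1 otherwise.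
-- If X terms with entry prime to p (these have maximal order) and Y terms with entry divisible by p
-- are placed at C_{p^b}, this gives |S| ≤ Σᵢ (p^{aᵢ} − 1) + X + Y and X + pY ≤ p^b − 1. Hence
-- d(G) = Σᵢ (p^{aᵢ} − 1) + p^b − 1, and |S| ≥ d(G) − δ forces (p − 1) Y ≤ δ, so
-- X ≥ p^b − 1 − δ − ⌊δ/(p − 1)⌋; p^{aᵢ} − 1 copies of each eᵢ with X copies of e_r and Y copies
-- of p e_r attain the bound.

module Submission where

open import Defs
open import Data.Nat using (ℕ; _∸_; _^_; _≤_; _<_; NonZero)
open import Data.Nat.DivMod using (_/_)
open import Data.Nat.Primality using (Prime)
open import Data.Fin using (Fin) renaming (_≤_ to _≤ᶠ_)

open import Data.Bool using (true; false; if_then_else_; _∧_; not)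
open import Data.Empty using (⊥-elim)
open import Data.Fin using (zero; suc; inject₁; fromℕ)
open import Data.Fin.Properties using (_≟_; all?; ¬∀⟶∃¬)
open import Data.Integer using (ℤ; +_; -_; _+_; _*_; _-_; 0ℤ; 1ℤ; ∣_∣)
import Data.Integer.Properties as ℤ
open import Data.Integer.Tactic.RingSolver using () renaming (solve-∀ to solve-∀ℤ)
open import Data.List using (List; []; _∷_; _++_; foldr; map; replicate; length)
import Data.List.Properties as List
open import Data.List.Relation.Binary.Sublist.Propositional using (_⊆_; []; _∷_; _∷ʳ_)
open import Data.List.Relation.Binary.Sublist.Propositional.Properties using (All-resp-⊆)
open import Data.List.Relation.Unary.All using (All; []; _∷_)
open import Data.List.Relation.Unary.All.Properties using (++⁺; replicate⁺)
open import Data.Nat as ℕ using (zero; suc; z≤n; s≤s; _!)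
import Data.Nat.Properties as ℕ
open import Data.Nat.Properties using (_!*_!≢0)
open import Data.Nat.Combinatorics using (_C_; nCk+nC[k+1]≡[n+1]C[k+1]; nCn≡1; k![n∸k]!∣n!)
open import Data.Nat.Combinatorics.Specification using (nCk≡n!/k![n-k]!; k>n⇒nCk≡0)
open import Data.Nat.DivMod using (m*[n/m]≡n; m*n/n≡m; /-monoˡ-≤; m/n*n≤m)
open import Data.Nat.Divisibility
  using (_∣_; divides; _∣?_; ∣⇒≤; ∣-trans; ∣-refl; m∣m*n; *-monoʳ-∣; *-cancelˡ-∣; 1∣_; _∣0
        ; ∣m+n∣m⇒∣n; ∣m∣n⇒∣m+n)
open import Data.Nat.ListAction using (sum)
open import Data.Nat.ListAction.Properties using (sum-++)
open import Data.Nat.Primality using (prime; euclidsLemma; prime⇒nonZero)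
open import Data.Nat.Tactic.RingSolver using (solve-∀)
open import Data.Product using (Σ; _,_; proj₁; proj₂; _×_; ∃; ∃₂)
open import Data.Sum using (_⊎_; inj₁; inj₂)
open import Data.Vec using (Vec; tabulate; lookup) renaming (replicate to replicateᵛ)
open import Data.Vec.Properties using (tabulate-cong; lookup∘tabulate; tabulate∘lookup; lookup-replicate)
open import Function using (_∘_)
open import Relation.Nullary using (¬_; Dec; yes; no; does)
open import Relation.Binary.PropositionalEquality

module Congruence (P : ℤ) where

  infix 4 _≈_
  record _≈_ (a b : ℤ) : Set where
    constructor _,_
    field
      quotient : ℤ
      equation : a ≡ b + quotient * P

  ≈-refl : ∀ {a} → a ≈ a
  ≈-refl {a} = 0ℤ , identity a P
    where identity : ∀ a P → a ≡ a + 0ℤ * P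
          identity = solve-∀ℤ

  ≈-reflexive : ∀ {a b} → a ≡ b → a ≈ b
  ≈-reflexive refl = ≈-refl

  ≈-sym : ∀ {a b} → a ≈ b → b ≈ a
  ≈-sym {b = b} (t , refl) = - t , identity b t P
    where identity : ∀ b t P → b ≡ b + t * P + - t * P
          identity = solve-∀ℤ

  ≈-trans : ∀ {a b c} → a ≈ b → b ≈ c → a ≈ c
  ≈-trans {c = c} (t , refl) (u , refl) = t + u , identity c t u P
    where identity : ∀ c t u P → c + u * P + t * P ≡ c + (t + u) * P
          identity = solve-∀ℤ

  ≈-+ : ∀ {a b c d} → a ≈ b → c ≈ d → a + c ≈ b + d
  ≈-+ {b = b} {d = d} (t , refl) (u , refl) = t + u , identity b d t u P
    where identity : ∀ b d t u P → b + t * P + (d + u * P) ≡ b + d + (t + u) * P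
          identity = solve-∀ℤ

  ≈-neg : ∀ {a b} → a ≈ b → - a ≈ - b
  ≈-neg {b = b} (t , refl) = - t , identity b t P
    where identity : ∀ b t P → - (b + t * P) ≡ - b + - t * P
          identity = solve-∀ℤ

  ≈-- : ∀ {a b c d} → a ≈ b → c ≈ d → a - c ≈ b - d
  ≈-- a≈b c≈d = ≈-+ a≈b (≈-neg c≈d)

  ≈-*ˡ : ∀ c {a b} → a ≈ b → c * a ≈ c * b
  ≈-*ˡ c {b = b} (t , refl) = c * t , identity b c t P
    where identity : ∀ b c t P → c * (b + t * P) ≡ c * b + c * t * P
          identity = solve-∀ℤ

  multiple≈0 : ∀ c → c * P ≈ 0ℤ
  multiple≈0 c = c , sym (ℤ.+-identityˡ (c * P))

  unit≉0 : 2 ℕ.≤ ∣ P ∣ → ∀ {u} → ∣ u ∣ ≡ 1 → ¬ u ≈ 0ℤ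
  unit≉0 2≤∣P∣ {u} ∣u∣≡1 (t , u≡tP) = ℕ.<⇒≱ 2≤∣P∣ (∣⇒≤ ∣P∣∣1)
    where
      ∣P∣∣1 : ∣ P ∣ ∣ 1
      ∣P∣∣1 = divides ∣ t ∣ (begin
        1                 ≡⟨ sym ∣u∣≡1 ⟩
        ∣ u ∣             ≡⟨ cong ∣_∣ (trans u≡tP (ℤ.+-identityˡ (t * P))) ⟩
        ∣ t * P ∣         ≡⟨ ℤ.abs-* t P ⟩
        ∣ t ∣ ℕ.* ∣ P ∣   ∎)
        where open ≡-Reasoning

∑ : ℕ → (ℕ → ℤ) → ℤ
∑ zero    f = 0ℤ
∑ (suc n) f = f 0 + ∑ n (λ i → f (suc i))

∑-cong : ∀ n {f g} → (∀ i → f i ≡ g i) → ∑ n f ≡ ∑ n g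
∑-cong zero    f≡g = refl
∑-cong (suc n) f≡g = cong₂ _+_ (f≡g 0) (∑-cong n (λ i → f≡g (suc i)))

∑-snoc : ∀ n f → ∑ (suc n) f ≡ ∑ n f + f n
∑-snoc zero    f = trans (ℤ.+-identityʳ (f 0)) (sym (ℤ.+-identityˡ (f 0)))
∑-snoc (suc n) f rewrite ∑-snoc n (λ i → f (suc i)) = sym (ℤ.+-assoc (f 0) _ _)

∑-+ : ∀ n f g → ∑ n (λ i → f i + g i) ≡ ∑ n f + ∑ n g
∑-+ zero    f g = refl
∑-+ (suc n) f g rewrite ∑-+ n (λ i → f (suc i)) (λ i → g (suc i)) = interchange (f 0) (g 0) _ _
  where interchange : ∀ a b c d → a + b + (c + d) ≡ a + c + (b + d)
        interchange = solve-∀ℤ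

module _ (P : ℤ) where
  open Congruence P

  ∑-≈ : ∀ n {f g} → (∀ i → f i ≈ g i) → ∑ n f ≈ ∑ n g
  ∑-≈ zero    f≈g = ≈-refl
  ∑-≈ (suc n) f≈g = ≈-+ (f≈g 0) (∑-≈ n (λ i → f≈g (suc i)))

  ∑-≈0 : ∀ n f → (∀ i → i < n → f i ≈ 0ℤ) → ∑ n f ≈ 0ℤ
  ∑-≈0 zero    f f≈0 = ≈-refl
  ∑-≈0 (suc n) f f≈0 = ≈-+ (f≈0 0 (s≤s z≤n)) (∑-≈0 n _ (λ i i<n → f≈0 (suc i) (s≤s i<n)))

prime⇒2≤p : ∀ {p} → Prime p → 2 ≤ p
prime⇒2≤p {p} (prime _) = ℕ.nonTrivial⇒n>1 p

prime∣n!⇒p≤n : ∀ {p} n → Prime p → p ∣ n ! → p ≤ n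
prime∣n!⇒p≤n zero    pp p∣1 = ⊥-elim (ℕ.<⇒≱ (prime⇒2≤p pp) (∣⇒≤ p∣1))
prime∣n!⇒p≤n (suc n) pp p∣n! with euclidsLemma (suc n) (n !) pp p∣n!
... | inj₁ p∣1+n = ∣⇒≤ p∣1+n
... | inj₂ p∣n!  = ℕ.m≤n⇒m≤1+n (prime∣n!⇒p≤n n pp p∣n!)

k![n∸k]!nCk≡n! : ∀ {n k} → k ≤ n → k ! ℕ.* (n ∸ k) ! ℕ.* (n C k) ≡ n !
k![n∸k]!nCk≡n! {n} {k} k≤n = trans (cong (k ! ℕ.* (n ∸ k) ! ℕ.*_) (nCk≡n!/k![n-k]! k≤n))
                                   (m*[n/m]≡n {{k !* (n ∸ k) !≢0}} (k![n∸k]!∣n! k≤n))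

prime∣pCk : ∀ {p k} → Prime p → 0 < k → k < p → p ∣ p C k
prime∣pCk {p@(suc p′)} {k} pp 0<k k<p
  with euclidsLemma (k ! ℕ.* (p ∸ k) !) (p C k) pp
         (subst (p ∣_) (sym (k![n∸k]!nCk≡n! (ℕ.<⇒≤ k<p))) (m∣m*n (p′ !)))
... | inj₂ p∣pCk = p∣pCk
... | inj₁ p∣k![p-k]! with euclidsLemma (k !) ((p ∸ k) !) pp p∣k![p-k]!
...   | inj₁ p∣k!     = ⊥-elim (ℕ.<⇒≱ k<p (prime∣n!⇒p≤n k pp p∣k!))
...   | inj₂ p∣[p-k]! = ⊥-elim (ℕ.<⇒≱ (ℕ.∸-monoʳ-< 0<k (ℕ.<⇒≤ k<p)) (prime∣n!⇒p≤n _ pp p∣[p-k]!))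

∑-pascal : ∀ n (a : ℕ → ℤ) → ∑ (suc n) (λ i → + (n C i) * (a i + a (suc i)))
                           ≡ ∑ (suc (suc n)) (λ i → + (suc n C i) * a i)
∑-pascal n a = begin
    ∑ (suc n) (λ i → + (n C i) * (a i + a (suc i)))
      ≡⟨ ∑-cong (suc n) (λ i → ℤ.*-distribˡ-+ (+ (n C i)) (a i) (a (suc i))) ⟩
    ∑ (suc n) (λ i → + (n C i) * a i + + (n C i) * a (suc i))
      ≡⟨ ∑-+ (suc n) (λ i → + (n C i) * a i) (λ i → + (n C i) * a (suc i)) ⟩
    (1ℤ * a 0 + ∑ n upper) + ∑ (suc n) lower
      ≡⟨ cong (λ z → (1ℤ * a 0 + z) + ∑ (suc n) lower) upper-extend ⟩
    (1ℤ * a 0 + ∑ (suc n) upper) + ∑ (suc n) lower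
      ≡⟨ reassociate (1ℤ * a 0) _ _ ⟩
    1ℤ * a 0 + (∑ (suc n) lower + ∑ (suc n) upper)
      ≡⟨ cong (λ z → 1ℤ * a 0 + z) (sym (∑-+ (suc n) lower upper)) ⟩
    1ℤ * a 0 + ∑ (suc n) (λ i → lower i + upper i)
      ≡⟨ cong (λ z → 1ℤ * a 0 + z) (∑-cong (suc n) pascal) ⟩
    ∑ (suc (suc n)) (λ i → + (suc n C i) * a i) ∎
  where
    open ≡-Reasoning
    lower upper : ℕ → ℤ
    lower i = + (n C i) * a (suc i)
    upper i = + (n C suc i) * a (suc i)
    upper-extend : ∑ n upper ≡ ∑ (suc n) upper
    upper-extend = sym (begin
      ∑ (suc n) upper                       ≡⟨ ∑-snoc n upper ⟩
      ∑ n upper + + (n C suc n) * a (suc n) ≡⟨ cong (λ z → ∑ n upper + + z * a (suc n)) (k>n⇒nCk≡0 (ℕ.n<1+n n)) ⟩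
      ∑ n upper + 0ℤ * a (suc n)            ≡⟨ ℤ.+-identityʳ (∑ n upper) ⟩
      ∑ n upper                             ∎)
    pascal : ∀ i → lower i + upper i ≡ + (suc n C suc i) * a (suc i)
    pascal i = begin
      lower i + upper i                         ≡⟨ ℤ.*-distribʳ-+ (a (suc i)) (+ (n C i)) (+ (n C suc i)) ⟨
      (+ (n C i) + + (n C suc i)) * a (suc i)   ≡⟨ cong (_* a (suc i)) (ℤ.pos-+ (n C i) (n C suc i)) ⟨
      + (n C i ℕ.+ n C suc i) * a (suc i)       ≡⟨ cong (λ z → + z * a (suc i)) (nCk+nC[k+1]≡[n+1]C[k+1] n i) ⟩
      + (suc n C suc i) * a (suc i)             ∎
    reassociate : ∀ x y z → (x + y) + z ≡ x + (z + y)
    reassociate = solve-∀ℤ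

-- Only the two extreme terms of the binomial sum survive modulo p.
∑-frobenius : ∀ {p} → Prime p → (a : ℕ → ℤ) →
              Congruence._≈_ (+ p) (∑ (suc p) (λ i → + (p C i) * a i) - a 0) (a p)
∑-frobenius {p@(suc p′)} pp a =
  ≈-trans (≈-- (≈-+ (≈-refl {1ℤ * a 0}) (≈-trans (≈-reflexive (∑-snoc p′ (λ i → term (suc i)))) middle≈0+last))
               (≈-refl {a 0}))
          (≈-reflexive (cancel (a 0) (a p)))
  where
    open Congruence (+ p)
    term : ℕ → ℤ
    term i = + (p C i) * a i
    middle≈0+last : ∑ p′ (λ i → term (suc i)) + term p ≈ 0ℤ + a p
    middle≈0+last = ≈-+ (∑-≈0 (+ p) p′ (λ i → term (suc i)) inner≈0)
                        (≈-reflexive (trans (cong (λ z → + z * a p) (nCn≡1 p)) (ℤ.*-identityˡ (a p))))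
      where
        inner≈0 : ∀ i → i < p′ → term (suc i) ≈ 0ℤ
        inner≈0 i i<p′ with prime∣pCk pp (s≤s z≤n) (s≤s i<p′)
        ... | divides q pCi≡qp = ≈-trans (≈-reflexive (begin
                + (p C suc i) * a (suc i)     ≡⟨ cong (λ z → + z * a (suc i)) pCi≡qp ⟩
                + (q ℕ.* p) * a (suc i)       ≡⟨ cong (_* a (suc i)) (ℤ.pos-* q p) ⟩
                + q * + p * a (suc i)         ≡⟨ swap (+ q) (+ p) (a (suc i)) ⟩
                + q * a (suc i) * + p         ∎)) (multiple≈0 (+ q * a (suc i)))
          where
            open ≡-Reasoning
            swap : ∀ x y z → x * y * z ≡ x * z * y
            swap = solve-∀ℤ
    cancel : ∀ x y → 1ℤ * x + (0ℤ + y) - x ≡ y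
    cancel = solve-∀ℤ

module Differences (P : ℤ) (k : ℕ) where
  open Congruence P public

  -- Points are vectors so that shifting is associative up to ≡ (no function extensionality).
  Point : Set
  Point = Vec ℕ k

  Shift : Set
  Shift = Fin k → ℕ

  Fn : Set
  Fn = Point → ℤ

  _⊕_ : Point → Shift → Point
  v ⊕ u = tabulate (λ i → lookup v i ℕ.+ u i)

  _+ˢ_ : Shift → Shift → Shift
  (u +ˢ w) i = u i ℕ.+ w i

  lookup-⊕ : ∀ v u i → lookup (v ⊕ u) i ≡ lookup v i ℕ.+ u i
  lookup-⊕ v u i = lookup∘tabulate _ i

  ⊕-assoc : ∀ v u w → (v ⊕ u) ⊕ w ≡ v ⊕ (u +ˢ w)
  ⊕-assoc v u w = tabulate-cong (λ i →
    trans (cong (ℕ._+ w i) (lookup-⊕ v u i)) (ℕ.+-assoc (lookup v i) (u i) (w i)))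

  ⊕-cong : ∀ v {u w} → (∀ i → u i ≡ w i) → v ⊕ u ≡ v ⊕ w
  ⊕-cong v u≡w = tabulate-cong (λ i → cong (lookup v i ℕ.+_) (u≡w i))

  ⊕-comm : ∀ v u w → (v ⊕ u) ⊕ w ≡ (v ⊕ w) ⊕ u
  ⊕-comm v u w = trans (⊕-assoc v u w)
    (trans (⊕-cong v (λ i → ℕ.+-comm (u i) (w i))) (sym (⊕-assoc v w u)))

  ⊕-identityʳ : ∀ v → v ⊕ (λ _ → 0) ≡ v
  ⊕-identityʳ v = trans (tabulate-cong (λ i → ℕ.+-identityʳ (lookup v i))) (tabulate∘lookup v)

  infix 4 _≋_
  record _≋_ (F G : Fn) : Set where
    constructor mk≋
    field
      pointwise : ∀ v → F v ≈ G v
  open _≋_ public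

  ≋-refl : ∀ {F} → F ≋ F
  ≋-refl = mk≋ λ _ → ≈-refl

  ≋-reflexive : ∀ {F G} → F ≡ G → F ≋ G
  ≋-reflexive refl = ≋-refl

  ≋-sym : ∀ {F G} → F ≋ G → G ≋ F
  ≋-sym F≋G = mk≋ λ v → ≈-sym (pointwise F≋G v)

  ≋-trans : ∀ {F G H} → F ≋ G → G ≋ H → F ≋ H
  ≋-trans F≋G G≋H = mk≋ λ v → ≈-trans (pointwise F≋G v) (pointwise G≋H v)

  0F : Fn
  0F _ = 0ℤ

  _+F_ : Fn → Fn → Fn
  (F +F G) v = F v + G v

  +F-cong : ∀ {F F′ G G′} → F ≋ F′ → G ≋ G′ → F +F G ≋ F′ +F G′
  +F-cong F≋F′ G≋G′ = mk≋ λ v → ≈-+ (pointwise F≋F′ v) (pointwise G≋G′ v)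

  translate : Shift → Fn → Fn
  translate u F v = F (v ⊕ u)

  Δ : Shift → Fn → Fn
  Δ u F v = F (v ⊕ u) - F v

  Δ-cong : ∀ u {F G} → F ≋ G → Δ u F ≋ Δ u G
  Δ-cong u F≋G = mk≋ λ v → ≈-- (pointwise F≋G (v ⊕ u)) (pointwise F≋G v)

  Δ-congˡ : ∀ {u w} F → (∀ i → u i ≡ w i) → Δ u F ≋ Δ w F
  Δ-congˡ F u≡w = mk≋ λ v → ≈-reflexive (cong (λ x → F x - F v) (⊕-cong v u≡w))

  Δ-+ : ∀ u F G → Δ u (F +F G) ≋ Δ u F +F Δ u G
  Δ-+ u F G = mk≋ λ v → ≈-reflexive (distrib (F (v ⊕ u)) (G (v ⊕ u)) (F v) (G v))
    where distrib : ∀ a b c d → (a + b) - (c + d) ≡ (a - c) + (b - d)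
          distrib = solve-∀ℤ

  Δ-comm : ∀ u w F → Δ u (Δ w F) ≋ Δ w (Δ u F)
  Δ-comm u w F = mk≋ λ v → ≈-reflexive (trans
    (exchange (F ((v ⊕ u) ⊕ w)) (F (v ⊕ u)) (F (v ⊕ w)) (F v))
    (cong (λ x → (F x - F (v ⊕ w)) - (F (v ⊕ u) - F v)) (⊕-comm v u w)))
    where exchange : ∀ a b c d → (a - b) - (c - d) ≡ (a - c) - (b - d)
          exchange = solve-∀ℤ

  Δ-+ˢ : ∀ u w F → Δ (u +ˢ w) F ≋ Δ u (translate w F) +F Δ w F
  Δ-+ˢ u w F = mk≋ λ v → ≈-reflexive (trans
    (cong (λ x → F x - F v) (sym (⊕-assoc v u w)))
    (telescope (F ((v ⊕ u) ⊕ w)) (F (v ⊕ w)) (F v)))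
    where telescope : ∀ a b c → a - c ≡ (a - b) + (b - c)
          telescope = solve-∀ℤ

  Δ-zero : ∀ F → Δ (λ _ → 0) F ≋ 0F
  Δ-zero F = mk≋ λ v → ≈-reflexive (trans (cong (λ x → F x - F v) (⊕-identityʳ v)) (ℤ.+-inverseʳ (F v)))

  Δ* : List Shift → Fn → Fn
  Δ* us F = foldr Δ F us

  Δ*-cong : ∀ us {F G} → F ≋ G → Δ* us F ≋ Δ* us G
  Δ*-cong []       F≋G = F≋G
  Δ*-cong (u ∷ us) F≋G = Δ-cong u (Δ*-cong us F≋G)

  Δ*-+ : ∀ us F G → Δ* us (F +F G) ≋ Δ* us F +F Δ* us G
  Δ*-+ []       F G = ≋-refl
  Δ*-+ (u ∷ us) F G = ≋-trans (Δ-cong u (Δ*-+ us F G)) (Δ-+ u (Δ* us F) (Δ* us G))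

  Δ*-0F : ∀ us → Δ* us 0F ≋ 0F
  Δ*-0F []       = ≋-refl
  Δ*-0F (u ∷ us) = Δ-cong u (Δ*-0F us)

  Δ-Δ*-comm : ∀ u us F → Δ u (Δ* us F) ≋ Δ* us (Δ u F)
  Δ-Δ*-comm u []       F = ≋-refl
  Δ-Δ*-comm u (w ∷ us) F = ≋-trans (Δ-comm u w (Δ* us F)) (Δ-cong w (Δ-Δ*-comm u us F))

  Δ*-++ : ∀ us ws F → Δ* (us ++ ws) F ≡ Δ* us (Δ* ws F)
  Δ*-++ us ws F = List.foldr-++ Δ F us ws

  Δⁿ : ℕ → Shift → Fn → Fn
  Δⁿ n u = Δ* (replicate n u)

  Δⁿ-suc : ∀ n u F → Δⁿ n u (Δ u F) ≡ Δ u (Δⁿ n u F)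
  Δⁿ-suc zero    u F = refl
  Δⁿ-suc (suc n) u F = cong (Δ u) (Δⁿ-suc n u F)

  Δⁿ-+ⁿ : ∀ m n u F → Δⁿ (m ℕ.+ n) u F ≡ Δⁿ m u (Δⁿ n u F)
  Δⁿ-+ⁿ zero    n u F = refl
  Δⁿ-+ⁿ (suc m) n u F = cong (Δ u) (Δⁿ-+ⁿ m n u F)

module Frobenius {p} (pp : Prime p) (k : ℕ) where
  open Differences (+ p) k

  translate-binomial : ∀ n u F →
    translate (n · u) F ≋ (λ v → ∑ (suc n) (λ i → + (n C i) * Δⁿ i u F v))
  translate-binomial zero u F = mk≋ λ v → ≈-reflexive
    (trans (cong F (⊕-identityʳ v)) (sym (trans (ℤ.+-identityʳ _) (ℤ.*-identityˡ (F v)))))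
  translate-binomial (suc n) u F =
    ≋-trans peel (≋-trans (translate-binomial n u (translate u F)) (mk≋ pascal))
    where
      peel : translate (suc n · u) F ≋ translate (n · u) (translate u F)
      peel = mk≋ λ v → ≈-reflexive (cong F (sym (trans (⊕-assoc v (n · u) u)
                                                       (⊕-cong v (λ i → ℕ.+-comm (n ℕ.* u i) (u i))))))
      translate≋F+ΔF : translate u F ≋ F +F Δ u F
      translate≋F+ΔF = mk≋ λ v → ≈-reflexive (split (F (v ⊕ u)) (F v))
        where split : ∀ a b → a ≡ b + (a - b)
              split = solve-∀ℤ
      pascal : ∀ v → ∑ (suc n) (λ i → + (n C i) * Δⁿ i u (translate u F) v)
                   ≈ ∑ (suc (suc n)) (λ i → + (suc n C i) * Δⁿ i u F v)
      pascal v = ≈-trans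
        (∑-≈ (+ p) (suc n) (λ i → ≈-*ˡ (+ (n C i))
          (pointwise (≋-trans (Δ*-cong (replicate i u) translate≋F+ΔF) (Δ*-+ (replicate i u) F (Δ u F))) v)))
        (≈-reflexive (trans
          (∑-cong (suc n) (λ i → cong (λ G → + (n C i) * (Δⁿ i u F v + G v)) (Δⁿ-suc i u F)))
          (∑-pascal n (λ i → Δⁿ i u F v))))

  Δ-frobenius : ∀ u F → Δ (p · u) F ≋ Δⁿ p u F
  Δ-frobenius u F = mk≋ λ v →
    ≈-trans (≈-- (pointwise (translate-binomial p u F) v) (≈-refl {F v})) (∑-frobenius pp (λ i → Δⁿ i u F v))

  Δ-frobenius^ : ∀ e u F → Δ ((p ^ e) · u) F ≋ Δⁿ (p ^ e) u F
  Δ-frobenius^ zero    u F = Δ-congˡ F (λ i → ℕ.+-identityʳ (u i))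
  Δ-frobenius^ (suc e) u F =
    ≋-trans (Δ-congˡ F (λ i → ℕ.*-assoc p (p ^ e) (u i)))
      (≋-trans (Δ-frobenius ((p ^ e) · u) F) (iterate p F))
    where
      iterate : ∀ n F → Δⁿ n ((p ^ e) · u) F ≋ Δⁿ (n ℕ.* p ^ e) u F
      iterate zero    F = ≋-refl
      iterate (suc n) F = ≋-trans (Δ-cong ((p ^ e) · u) (iterate n F))
        (≋-trans (Δ-frobenius^ e u (Δⁿ (n ℕ.* p ^ e) u F))
                 (≋-reflexive (sym (Δⁿ-+ⁿ (p ^ e) (n ℕ.* p ^ e) u F))))

single : ∀ {k} → Fin k → ℕ → Fin k → ℕ
single j c i = if does (i ≟ j) then c else 0

single-diag : ∀ {k} (j : Fin k) c → single j c j ≡ c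
single-diag j c with j ≟ j
... | yes _   = refl
... | no j≢j = ⊥-elim (j≢j refl)

single-scale : ∀ {k} n (j : Fin k) c i → n ℕ.* single j c i ≡ single j (n ℕ.* c) i
single-scale n j c i with i ≟ j
... | yes _ = refl
... | no _  = ℕ.*-zeroʳ n

sumFin : ∀ n → (Fin n → ℕ) → ℕ
sumFin zero    f = 0
sumFin (suc n) f = f zero ℕ.+ sumFin n (λ j → f (suc j))

sumFin-cong : ∀ n {f g} → (∀ j → f j ≡ g j) → sumFin n f ≡ sumFin n g
sumFin-cong zero    f≡g = refl
sumFin-cong (suc n) f≡g = cong₂ ℕ._+_ (f≡g zero) (sumFin-cong n (λ j → f≡g (suc j)))

sumFin-zero : ∀ n → sumFin n (λ _ → 0) ≡ 0
sumFin-zero zero    = refl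
sumFin-zero (suc n) = sumFin-zero n

sumFin-+ : ∀ n (f g : Fin n → ℕ) → sumFin n (λ j → f j ℕ.+ g j) ≡ sumFin n f ℕ.+ sumFin n g
sumFin-+ zero    f g = refl
sumFin-+ (suc n) f g rewrite sumFin-+ n (λ j → f (suc j)) (λ j → g (suc j)) =
  interchange (f zero) (g zero) _ _
  where interchange : ∀ a b c d → a ℕ.+ b ℕ.+ (c ℕ.+ d) ≡ a ℕ.+ c ℕ.+ (b ℕ.+ d)
        interchange = solve-∀

sumFin-single : ∀ n (f : Fin n → ℕ) i → sumFin n (λ j → single j (f j) i) ≡ f i
sumFin-single (suc n) f zero    = trans (cong (f zero ℕ.+_) (sumFin-zero n)) (ℕ.+-identityʳ (f zero))
sumFin-single (suc n) f (suc i) = sumFin-single n (λ j → f (suc j)) i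

count : ∀ {k} → Fin k → List (Fin k) → ℕ
count j []      = 0
count j (x ∷ ℓ) = single j 1 x ℕ.+ count j ℓ

removeAll : ∀ {k} → Fin k → List (Fin k) → List (Fin k)
removeAll j []      = []
removeAll j (x ∷ ℓ) = if does (x ≟ j) then removeAll j ℓ else x ∷ removeAll j ℓ

count-++ : ∀ {k} (j : Fin k) ℓ ℓ′ → count j (ℓ ++ ℓ′) ≡ count j ℓ ℕ.+ count j ℓ′
count-++ j []      ℓ′ = refl
count-++ j (x ∷ ℓ) ℓ′ = trans (cong (single j 1 x ℕ.+_) (count-++ j ℓ ℓ′))
                              (sym (ℕ.+-assoc (single j 1 x) (count j ℓ) (count j ℓ′)))

count-replicate : ∀ {k} (j x : Fin k) n → count j (replicate n x) ≡ single j n x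
count-replicate j x zero with x ≟ j
... | yes _ = refl
... | no _  = refl
count-replicate j x (suc n) rewrite count-replicate j x n with x ≟ j
... | yes _ = refl
... | no _  = refl

length≡sumFin-count : ∀ {k} (ℓ : List (Fin k)) → length ℓ ≡ sumFin k (λ j → count j ℓ)
length≡sumFin-count {k} []      = sym (sumFin-zero k)
length≡sumFin-count {k} (x ∷ ℓ) = begin
  suc (length ℓ)                                            ≡⟨ cong₂ ℕ._+_ (sym (sumFin-single k (λ _ → 1) x))
                                                                          (length≡sumFin-count ℓ) ⟩
  sumFin k (λ j → single j 1 x) ℕ.+ sumFin k (λ j → count j ℓ) ≡⟨ sym (sumFin-+ k _ _) ⟩
  sumFin k (λ j → count j (x ∷ ℓ))                           ∎
  where open ≡-Reasoning

indicator : ∀ {A : Set} → Dec A → ℤ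
indicator a? = if does a? then 1ℤ else 0ℤ

indicator-yes : ∀ {A : Set} (a? : Dec A) → A → indicator a? ≡ 1ℤ
indicator-yes (yes _) a = refl
indicator-yes (no ¬a) a = ⊥-elim (¬a a)

indicator-no : ∀ {A : Set} (a? : Dec A) → ¬ A → indicator a? ≡ 0ℤ
indicator-no (yes a) ¬a = ⊥-elim (¬a a)
indicator-no (no _)  ¬a = refl

indicator-⇔ : ∀ {A B : Set} (a? : Dec A) (b? : Dec B) → (A → B) → (B → A) → indicator a? ≡ indicator b?
indicator-⇔ (yes a) b? A⇒B B⇒A = sym (indicator-yes b? (A⇒B a))
indicator-⇔ (no ¬a) b? A⇒B B⇒A = sym (indicator-no b? (¬a ∘ B⇒A))

module WeightedChoice {p} (pp : Prime p) {k} (m : Moduli k)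
       (m-power : ∀ j → ∃ λ e → m j ≡ p ^ e)
       (weight : Elem k → Fin k → ℕ)
       (weight-power : ∀ s j → ∃ λ e → weight s j ≡ p ^ e)
       (weight∣ : ∀ s j → weight s j ∣ s j) where

  open Differences (+ p) k
  open Frobenius pp k

  unit : Fin k → Shift
  unit j = single j 1

  Periodic : Fn → Set
  Periodic H = ∀ j v → H (v ⊕ single j (m j)) ≡ H v

  translate-periodic : ∀ w {H} → Periodic H → Periodic (translate w H)
  translate-periodic w {H} per j v = trans (cong H (⊕-comm v (single j (m j)) w)) (per j (v ⊕ w))

  Δ-single-power : ∀ j e G → Δ (single j (p ^ e)) G ≋ Δⁿ (p ^ e) (unit j) G
  Δ-single-power j e G = ≋-trans
    (Δ-congˡ G (λ i → sym (trans (single-scale (p ^ e) j 1 i) (cong (λ c → single j c i) (ℕ.*-identityʳ (p ^ e))))))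
    (Δ-frobenius^ e (unit j) G)

  Δ-period-vanishes : ∀ j H → Periodic H → Δ (single j (m j)) H ≋ 0F
  Δ-period-vanishes j H per = mk≋ λ v → ≈-reflexive (trans (cong (_- H v) (per j v)) (ℤ.+-inverseʳ (H v)))

  Δⁿ-period-vanishes : ∀ j c H → m j ≤ c → Periodic H → Δⁿ c (unit j) H ≋ 0F
  Δⁿ-period-vanishes j c H m≤c per with m-power j
  ... | e , m≡p^e = ≋-trans
    (≋-reflexive (trans (cong (λ n → Δⁿ n (unit j) H) (sym (ℕ.m∸n+n≡m m≤c))) (Δⁿ-+ⁿ (c ∸ m j) (m j) (unit j) H)))
    (≋-trans (Δ*-cong (replicate (c ∸ m j) (unit j)) Δⁿ[m]≋0) (Δ*-0F (replicate (c ∸ m j) (unit j))))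
    where
      Δⁿ[m]≋0 : Δⁿ (m j) (unit j) H ≋ 0F
      Δⁿ[m]≋0 = subst (λ n → Δⁿ n (unit j) H ≋ 0F) (sym m≡p^e)
        (≋-trans (≋-sym (Δ-single-power j e H))
                 (subst (λ n → Δ (single j n) H ≋ 0F) m≡p^e (Δ-period-vanishes j H per)))

  ∂ : List (Fin k) → Fn → Fn
  ∂ ℓ = Δ* (map unit ℓ)

  ∂-++ : ∀ ℓ ℓ′ H → ∂ (ℓ ++ ℓ′) H ≡ ∂ ℓ (∂ ℓ′ H)
  ∂-++ ℓ ℓ′ H = trans (cong (λ us → Δ* us H) (List.map-++ unit ℓ ℓ′)) (Δ*-++ (map unit ℓ) (map unit ℓ′) H)

  ∂-replicate : ∀ n j H → ∂ (replicate n j) H ≡ Δⁿ n (unit j) H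
  ∂-replicate n j H = cong (λ us → Δ* us H) (List.map-replicate unit n j)

  ∂-separate : ∀ j ℓ H → ∂ ℓ H ≋ ∂ (removeAll j ℓ) (Δⁿ (count j ℓ) (unit j) H)
  ∂-separate j []      H = ≋-refl
  ∂-separate j (x ∷ ℓ) H with x ≟ j
  ... | yes refl = ≋-trans (Δ-cong (unit x) (∂-separate j ℓ H)) (Δ-Δ*-comm (unit x) (map unit (removeAll j ℓ)) _)
  ... | no _     = Δ-cong (unit x) (∂-separate j ℓ H)

  ∂-vanishes : ∀ j ℓ H → Periodic H → m j ≤ count j ℓ → ∂ ℓ H ≋ 0F
  ∂-vanishes j ℓ H per m≤count = ≋-trans (∂-separate j ℓ H)
    (≋-trans (Δ*-cong (map unit (removeAll j ℓ)) (Δⁿ-period-vanishes j _ H m≤count per))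
             (Δ*-0F (map unit (removeAll j ℓ))))

  record Closed (Q : Fn → Set) : Set where
    field
      0F∈ : Q 0F
      +F∈ : ∀ {F G} → Q F → Q G → Q (F +F G)
      ≋∈  : ∀ {F G} → F ≋ G → Q F → Q G

  module _ {Q : Fn → Set} (closed : Closed Q) where
    open Closed closed

    Δ-multiple∈ : ∀ u → (∀ G → Periodic G → Q (Δ u G)) → ∀ q G → Periodic G → Q (Δ (q · u) G)
    Δ-multiple∈ u Δu∈ zero    G per = ≋∈ (≋-sym (Δ-zero G)) 0F∈
    Δ-multiple∈ u Δu∈ (suc q) G per = ≋∈ (≋-sym (Δ-+ˢ u (q · u) G))
      (+F∈ (Δu∈ (translate (q · u) G) (translate-periodic (q · u) per)) (Δ-multiple∈ u Δu∈ q G per))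

    Δ-sumFin∈ : ∀ n (U : Fin n → Shift) → (∀ j G → Periodic G → Q (Δ (U j) G)) →
                ∀ G → Periodic G → Q (Δ (λ i → sumFin n (λ j → U j i)) G)
    Δ-sumFin∈ zero    U ΔU∈ G per = ≋∈ (≋-sym (Δ-zero G)) 0F∈
    Δ-sumFin∈ (suc n) U ΔU∈ G per = ≋∈ (≋-sym (Δ-+ˢ (U zero) (λ i → sumFin n (λ j → U (suc j) i)) G))
      (+F∈ (ΔU∈ zero _ (translate-periodic _ per)) (Δ-sumFin∈ n (λ j → U (suc j)) (λ j → ΔU∈ (suc j)) G per))

    -- u = Σⱼ qⱼ wⱼ eⱼ, and Δ of a sum of shifts telescopes into translates of the Δ of the summands.
    Δ∈ : (w : Shift) → (∀ j G → Periodic G → Q (Δ (single j (w j)) G)) →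
         ∀ u → (∀ j → w j ∣ u j) → ∀ G → Periodic G → Q (Δ u G)
    Δ∈ w generator u w∣u G per = ≋∈ (Δ-congˡ G (λ i → sumFin-single k u i))
      (Δ-sumFin∈ k (λ j → single j (u j)) single∈ G per)
      where
        single∈ : ∀ j G → Periodic G → Q (Δ (single j (u j)) G)
        single∈ j G per with w∣u j
        ... | divides q u≡qw =
          ≋∈ (Δ-congˡ G (λ i → trans (single-scale q j (w j) i) (cong (λ c → single j c i) (sym u≡qw))))
                                  (Δ-multiple∈ (single j (w j)) (generator j) q G per)

  vanishing-closed : ∀ (A : Set) S ℓ → Closed (λ G → A ⊎ Δ* S (∂ ℓ G) ≋ 0F)
  vanishing-closed A S ℓ = record
    { 0F∈ = inj₂ (≋-trans (Δ*-cong S (Δ*-0F (map unit ℓ))) (Δ*-0F S))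
    ; +F∈ = plus
    ; ≋∈  = respect
    }
    where
      plus : ∀ {F G} → A ⊎ Δ* S (∂ ℓ F) ≋ 0F → A ⊎ Δ* S (∂ ℓ G) ≋ 0F → A ⊎ Δ* S (∂ ℓ (F +F G)) ≋ 0F
      plus (inj₁ a) _        = inj₁ a
      plus (inj₂ _) (inj₁ a) = inj₁ a
      plus {F} {G} (inj₂ F≋0) (inj₂ G≋0) = inj₂ (≋-trans (Δ*-cong S (Δ*-+ (map unit ℓ) F G))
        (≋-trans (Δ*-+ S (∂ ℓ F) (∂ ℓ G)) (+F-cong F≋0 G≋0)))
      respect : ∀ {F G} → F ≋ G → A ⊎ Δ* S (∂ ℓ F) ≋ 0F → A ⊎ Δ* S (∂ ℓ G) ≋ 0F
      respect F≋G (inj₁ a)    = inj₁ a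
      respect F≋G (inj₂ F≋0) = inj₂ (≋-trans (Δ*-cong S (Δ*-cong (map unit ℓ) (≋-sym F≋G))) F≋0)

  Admissible : List (Fin k) → Set
  Admissible ℓ = ∀ j → count j ℓ < m j

  Choice : List Shift → Set
  Choice = All (λ _ → Fin k)

  expand : ∀ S → Choice S → List (Fin k)
  expand []      []      = []
  expand (s ∷ S) (j ∷ c) = replicate (weight s j) j ++ expand S c

  choice-or-vanish : ∀ S ℓ H → Periodic H →
    (Σ (Choice S) λ c → Admissible (ℓ ++ expand S c)) ⊎ Δ* S (∂ ℓ H) ≋ 0F
  choice-or-vanish [] ℓ H per with all? (λ j → count j ℓ ℕ.<? m j)
  ... | yes adm  = inj₁ ([] , subst Admissible (sym (List.++-identityʳ ℓ)) adm)
  ... | no ¬adm with ¬∀⟶∃¬ k _ (λ j → count j ℓ ℕ.<? m j) ¬adm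
  ...   | j , count≮m = inj₂ (∂-vanishes j ℓ H per (ℕ.≮⇒≥ count≮m))
  choice-or-vanish (s ∷ S) ℓ H per =
    conclude (Δ∈ (vanishing-closed Extendable S ℓ) (weight s) generator s (weight∣ s) H per)
    where
      Extendable : Set
      Extendable = Σ (Fin k) λ j → Σ (Choice S) λ c → Admissible ((ℓ ++ replicate (weight s j) j) ++ expand S c)

      generator : ∀ j G → Periodic G → Extendable ⊎ Δ* S (∂ ℓ (Δ (single j (weight s j)) G)) ≋ 0F
      generator j G per with weight-power s j | choice-or-vanish S (ℓ ++ replicate (weight s j) j) G per
      ... | _       | inj₁ (c , adm) = inj₁ (j , c , adm)
      ... | e , w≡p^e | inj₂ vanish   = inj₂ (≋-trans (Δ*-cong S (Δ*-cong (map unit ℓ) Δ≋∂))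
                                                 (≋-trans (≋-reflexive (cong (Δ* S) (sym (∂-++ ℓ _ G)))) vanish))
        where
          Δ≋∂ : Δ (single j (weight s j)) G ≋ ∂ (replicate (weight s j) j) G
          Δ≋∂ = subst (λ n → Δ (single j n) G ≋ ∂ (replicate n j) G) (sym w≡p^e)
                  (≋-trans (Δ-single-power j e G) (≋-reflexive (sym (∂-replicate (p ^ e) j G))))

      conclude : Extendable ⊎ Δ* S (∂ ℓ (Δ s H)) ≋ 0F →
                 (Σ (Choice (s ∷ S)) λ c → Admissible (ℓ ++ expand (s ∷ S) c)) ⊎ Δ* (s ∷ S) (∂ ℓ H) ≋ 0F
      conclude (inj₁ (j , c , adm)) =
        inj₁ (j ∷ c , subst Admissible (List.++-assoc ℓ (replicate (weight s j) j) (expand S c)) adm)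
      conclude (inj₂ vanish) =
        inj₂ (≋-trans (Δ-Δ*-comm s S (∂ ℓ H)) (≋-trans (Δ*-cong S (Δ-Δ*-comm s (map unit ℓ) H)) vanish))

  isZero? : ∀ x → Dec (IsZero m x)
  isZero? x = all? (λ i → m i ∣? x i)

  𝟙₀ : Fn
  𝟙₀ v = indicator (isZero? (lookup v))

  𝟙₀-periodic : Periodic 𝟙₀
  𝟙₀-periodic j v = indicator-⇔ (isZero? (lookup (v ⊕ single j (m j)))) (isZero? (lookup v))
    (λ z i → ∣m+n∣m⇒∣n (subst (m i ∣_) (trans (lookup-⊕ v (single j (m j)) i) (ℕ.+-comm (lookup v i) _)) (z i))
                       (m∣single i))
    (λ z i → subst (m i ∣_) (sym (lookup-⊕ v (single j (m j)) i)) (∣m∣n⇒∣m+n (z i) (m∣single i)))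
    where
      m∣single : ∀ i → m i ∣ single j (m j) i
      m∣single i with i ≟ j
      ... | yes refl = ∣-refl
      ... | no _     = m i ∣0

  Δ*-𝟙₀-vanishes : ∀ S v → (∀ T → T ⊆ S → ¬ IsZero m (λ i → lookup v i ℕ.+ σ T i)) → Δ* S 𝟙₀ v ≡ 0ℤ
  Δ*-𝟙₀-vanishes [] v no-zero-sum = indicator-no (isZero? (lookup v)) (λ z → no-zero-sum [] []
    (λ i → subst (m i ∣_) (sym (ℕ.+-identityʳ _)) (z i)))
  Δ*-𝟙₀-vanishes (s ∷ S) v no-zero-sum =
    cong₂ _-_ (Δ*-𝟙₀-vanishes S (v ⊕ s) with-s) (Δ*-𝟙₀-vanishes S v (λ T T⊆S → no-zero-sum T (s ∷ʳ T⊆S)))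
    where
      with-s : ∀ T → T ⊆ S → ¬ IsZero m (λ i → lookup (v ⊕ s) i ℕ.+ σ T i)
      with-s T T⊆S z = no-zero-sum (s ∷ T) (refl ∷ T⊆S) (λ i → subst (m i ∣_)
        (trans (cong (ℕ._+ σ T i) (lookup-⊕ v s i)) (ℕ.+-assoc _ (s i) (σ T i))) (z i))

  origin : Point
  origin = replicateᵛ k 0

  -- Expanding Δ_S 𝟙₀ at 0 as a signed sum over subsequences, only the empty one contributes.
  Δ*-𝟙₀-unit : ∀ S → ZeroSumFree m S → ∣ Δ* S 𝟙₀ origin ∣ ≡ 1
  Δ*-𝟙₀-unit [] _ = cong ∣_∣ (indicator-yes (isZero? (lookup origin))
    (λ i → subst (m i ∣_) (sym (lookup-replicate i 0)) (m i ∣0)))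
  Δ*-𝟙₀-unit (s ∷ S) zsf = begin
    ∣ Δ* S 𝟙₀ (origin ⊕ s) - Δ* S 𝟙₀ origin ∣ ≡⟨ cong (λ x → ∣ x - Δ* S 𝟙₀ origin ∣) shifted≡0 ⟩
    ∣ 0ℤ - Δ* S 𝟙₀ origin ∣                   ≡⟨ cong ∣_∣ (ℤ.+-identityˡ (- Δ* S 𝟙₀ origin)) ⟩
    ∣ - Δ* S 𝟙₀ origin ∣                      ≡⟨ ℤ.∣-i∣≡∣i∣ (Δ* S 𝟙₀ origin) ⟩
    ∣ Δ* S 𝟙₀ origin ∣                        ≡⟨ Δ*-𝟙₀-unit S (λ T T⊆S → zsf T (s ∷ʳ T⊆S)) ⟩
    1                                         ∎
    where
      open ≡-Reasoning
      shifted≡0 : Δ* S 𝟙₀ (origin ⊕ s) ≡ 0ℤ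
      shifted≡0 = Δ*-𝟙₀-vanishes S (origin ⊕ s) (λ T T⊆S z → zsf (s ∷ T) (refl ∷ T⊆S) (λ ()) (λ i →
        subst (m i ∣_) (cong (ℕ._+ σ T i) (trans (lookup-⊕ origin s i) (cong (ℕ._+ s i) (lookup-replicate i 0)))) (z i)))

  zeroSumFree⇒admissible : ∀ S → ZeroSumFree m S → Σ (Choice S) λ c → Admissible (expand S c)
  zeroSumFree⇒admissible S zsf with choice-or-vanish S [] 𝟙₀ 𝟙₀-periodic
  ... | inj₁ admissible = admissible
  ... | inj₂ vanish     = ⊥-elim (unit≉0 (prime⇒2≤p pp) (Δ*-𝟙₀-unit S zsf) (pointwise vanish origin))

snoc-inject₁ : ∀ {n} (f : Fin n → ℕ) b i → snoc f b (inject₁ i) ≡ f i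
snoc-inject₁ {suc n} f b zero    = refl
snoc-inject₁ {suc n} f b (suc i) = snoc-inject₁ (λ j → f (suc j)) b i

snoc-last : ∀ {n} (f : Fin n → ℕ) b → snoc f b (fromℕ n) ≡ b
snoc-last {zero}  f b = refl
snoc-last {suc n} f b = snoc-last (λ j → f (suc j)) b

snoc-map : ∀ {n} (g : ℕ → ℕ) (f : Fin n → ℕ) b j → snoc (λ i → g (f i)) (g b) j ≡ g (snoc f b j)
snoc-map {zero}  g f b zero    = refl
snoc-map {suc n} g f b zero    = refl
snoc-map {suc n} g f b (suc j) = snoc-map g (λ i → f (suc i)) b j

last-or-inject₁ : ∀ {n} (j : Fin (suc n)) → j ≡ fromℕ n ⊎ ∃ λ i → j ≡ inject₁ i
last-or-inject₁ {zero}  zero    = inj₁ refl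
last-or-inject₁ {suc n} zero    = inj₂ (zero , refl)
last-or-inject₁ {suc n} (suc j) with last-or-inject₁ j
... | inj₁ j≡last     = inj₁ (cong suc j≡last)
... | inj₂ (i , j≡i) = inj₂ (suc i , cong suc j≡i)

single-inject₁ : ∀ {n} (j : Fin n) c i → single (inject₁ j) c (inject₁ i) ≡ single j c i
single-inject₁ zero    c zero    = refl
single-inject₁ (suc j) c zero    = refl
single-inject₁ zero    c (suc i) = refl
single-inject₁ (suc j) c (suc i) = single-inject₁ j c i

single-last-inject₁ : ∀ {n} c (i : Fin n) → single (fromℕ n) c (inject₁ i) ≡ 0
single-last-inject₁ c zero    = refl
single-last-inject₁ c (suc i) = single-last-inject₁ c i

single-inject₁-last : ∀ {n} (j : Fin n) c → single (inject₁ j) c (fromℕ n) ≡ 0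
single-inject₁-last zero    c = refl
single-inject₁-last (suc j) c = single-inject₁-last j c

σ-++ : ∀ {k} (S T : List (Elem k)) i → σ (S ++ T) i ≡ σ S i ℕ.+ σ T i
σ-++ S T i = trans (cong sum (List.map-++ (λ g → g i) S T)) (sum-++ (map (λ g → g i) S) _)

σ-replicate : ∀ {k} n (g : Elem k) i → σ (replicate n g) i ≡ n ℕ.* g i
σ-replicate zero    g i = refl
σ-replicate (suc n) g i = cong (g i ℕ.+_) (σ-replicate n g i)

σ-mono : ∀ {k} {T S : List (Elem k)} → T ⊆ S → ∀ i → σ T i ≤ σ S i
σ-mono []                  i = z≤n
σ-mono (g ∷ʳ T⊆S)          i = ℕ.≤-trans (σ-mono T⊆S i) (ℕ.m≤n+m _ (g i))
σ-mono (_∷_ {x = g} refl T⊆S) i = ℕ.+-monoʳ-≤ (g i) (σ-mono T⊆S i)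

NonZeroElem : ∀ {k} → Elem k → Set
NonZeroElem {k} g = ∃ λ (i : Fin k) → 0 < g i

-- A nonempty subsum is positive in some coordinate, yet below the modulus there.
zeroSumFree-bounded : ∀ {k} (m : Moduli k) S → All NonZeroElem S → (∀ i → σ S i < m i) → ZeroSumFree m S
zeroSumFree-bounded m S nonzero bounded []      T⊆S T≢[] _ = T≢[] refl
zeroSumFree-bounded m S nonzero bounded (g ∷ T) T⊆S _ zero-sum with All-resp-⊆ T⊆S nonzero
... | (i , 0<gi) ∷ _ = ℕ.<⇒≱ 0<gi (subst (g i ≤_) σ≡0 (ℕ.m≤m+n (g i) (σ T i)))
  where
    σ≡0 : σ (g ∷ T) i ≡ 0
    σ≡0 with zero-sum i
    ... | divides zero    σ≡0 = σ≡0
    ... | divides (suc q) σ≡m = ⊥-elim (ℕ.<⇒≱ (ℕ.≤-<-trans (σ-mono T⊆S i) (bounded i))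
                                              (subst (m i ≤_) (sym σ≡m) (ℕ.m≤m+n (m i) (q ℕ.* m i))))

blocks : ∀ {k} n → (Fin n → ℕ) → (Fin n → Elem k) → List (Elem k)
blocks zero    c g = []
blocks (suc n) c g = replicate (c zero) (g zero) ++ blocks n (λ j → c (suc j)) (λ j → g (suc j))

length-blocks : ∀ {k} n c (g : Fin n → Elem k) → length (blocks n c g) ≡ sumFin n c
length-blocks zero    c g = refl
length-blocks (suc n) c g = trans (List.length-++ (replicate (c zero) (g zero)))
  (cong₂ ℕ._+_ (List.length-replicate (c zero)) (length-blocks n (λ j → c (suc j)) (λ j → g (suc j))))

σ-blocks : ∀ {k} n c (g : Fin n → Elem k) i → σ (blocks n c g) i ≡ sumFin n (λ j → c j ℕ.* g j i)
σ-blocks zero    c g i = refl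
σ-blocks (suc n) c g i = trans (σ-++ (replicate (c zero) (g zero)) _ i)
  (cong₂ ℕ._+_ (σ-replicate (c zero) (g zero) i) (σ-blocks n (λ j → c (suc j)) (λ j → g (suc j)) i))

All-blocks : ∀ {k} {P : Elem k → Set} n c g → (∀ j → P (g j)) → All P (blocks n c g)
All-blocks zero    c g Pg = []
All-blocks (suc n) c g Pg = ++⁺ (replicate⁺ (c zero) (Pg zero)) (All-blocks n _ _ (λ j → Pg (suc j)))

module _ {k} (m : Moduli k) where

  countMax-++ : ∀ {S T c d} → CountMax m S c → CountMax m T d → CountMax m (S ++ T) (c ℕ.+ d)
  countMax-++ cnil         T = T
  countMax-++ (cyes max S) T = cyes max (countMax-++ S T)
  countMax-++ (cno ¬max S) T = cno ¬max (countMax-++ S T)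

  countMax-replicate : ∀ n {g} → MaxOrder m g → CountMax m (replicate n g) n
  countMax-replicate zero    max = cnil
  countMax-replicate (suc n) max = cyes max (countMax-replicate n max)

  countMax-replicate-¬ : ∀ n {g} → ¬ MaxOrder m g → CountMax m (replicate n g) 0
  countMax-replicate-¬ zero    ¬max = cnil
  countMax-replicate-¬ (suc n) ¬max = cno ¬max (countMax-replicate-¬ n ¬max)

  countMax-blocks-¬ : ∀ n c g → (∀ j → ¬ MaxOrder m (g j)) → CountMax m (blocks n c g) 0
  countMax-blocks-¬ zero    c g ¬max = cnil
  countMax-blocks-¬ (suc n) c g ¬max =
    countMax-++ (countMax-replicate-¬ (c zero) (¬max zero)) (countMax-blocks-¬ n _ _ (λ j → ¬max (suc j)))

p^n∣j*x⇒p^n∣j : ∀ {p} → Prime p → ∀ n {j x} → ¬ p ∣ x → p ^ n ∣ j ℕ.* x → p ^ n ∣ j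
p^n∣j*x⇒p^n∣j pp zero    p∤x _ = 1∣ _
p^n∣j*x⇒p^n∣j {p} pp (suc n) {j} {x} p∤x p^n+1∣jx with euclidsLemma j x pp (∣-trans (m∣m*n (p ^ n)) p^n+1∣jx)
... | inj₂ p∣x = ⊥-elim (p∤x p∣x)
... | inj₁ (divides q refl) = subst (p ℕ.* p ^ n ∣_) (ℕ.*-comm p q) (*-monoʳ-∣ p p^n∣q)
  where
    p^n∣q : p ^ n ∣ q
    p^n∣q = p^n∣j*x⇒p^n∣j pp n p∤x (*-cancelˡ-∣ p {{prime⇒nonZero pp}}
              (subst (p ℕ.* p ^ n ∣_) (rearrange q p x) p^n+1∣jx))
      where rearrange : ∀ q p x → q ℕ.* p ℕ.* x ≡ p ℕ.* (q ℕ.* x)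
            rearrange = solve-∀

annihilator⇒m[l]∣ : ∀ {k} (m : Moduli k) l n → (∀ g → IsZero m (n · g)) → m l ∣ n
annihilator⇒m[l]∣ m l n annihilates = subst (m l ∣_) (trans (cong (n ℕ.*_) (single-diag l 1)) (ℕ.*-identityʳ n))
                                            (annihilates (single l 1) l)

module _ {k} (m : Moduli k) (l : Fin k) (0<m[l] : 0 < m l) (m∣m[l] : ∀ j → m j ∣ m l) where

  m[l]-annihilates : ∀ g → IsZero m (m l · g)
  m[l]-annihilates g i = ∣-trans (m∣m[l] i) (m∣m*n (g i))

  isExponent : IsExponent m (m l)
  isExponent = 0<m[l] , m[l]-annihilates ,
    λ n 0<n n<m[l] annihilates → ℕ.<⇒≱ n<m[l] (∣⇒≤ {{ℕ.>-nonZero 0<n}} (annihilator⇒m[l]∣ m l n annihilates))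

sumFin-inject₁ : ∀ n (h : Fin (suc n) → ℕ) → sumFin (suc n) h ≡ sumFin n (λ i → h (inject₁ i)) ℕ.+ h (fromℕ n)
sumFin-inject₁ zero    h = ℕ.+-identityʳ (h zero)
sumFin-inject₁ (suc n) h rewrite sumFin-inject₁ n (λ j → h (suc j)) = sym (ℕ.+-assoc (h zero) _ _)

sumFin-mono : ∀ n {f g : Fin n → ℕ} → (∀ j → f j ≤ g j) → sumFin n f ≤ sumFin n g
sumFin-mono zero    f≤g = z≤n
sumFin-mono (suc n) f≤g = ℕ.+-mono-≤ (f≤g zero) (sumFin-mono n (λ j → f≤g (suc j)))

module PrimePowerGroup {p} (pp : Prime p) {r′} (a : Fin r′ → ℕ) {b} (a<b : ∀ i → a i < b) (1≤b : 1 ≤ b) where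

  k : ℕ
  k = suc r′

  m : Moduli k
  m = snoc (λ i → p ^ a i) (p ^ b)

  last : Fin k
  last = fromℕ r′

  instance
    _ = prime⇒nonZero pp

  p≡1+[p∸1] : p ≡ suc (p ∸ 1)
  p≡1+[p∸1] = sym (ℕ.m+[n∸m]≡n (ℕ.<⇒≤ (prime⇒2≤p pp)))

  0<p^ : ∀ n → 0 < p ^ n
  0<p^ n = ℕ.m^n>0 p n

  p^∣p^ : ∀ {x y} → x ≤ y → p ^ x ∣ p ^ y
  p^∣p^ {x} {y} x≤y = divides (p ^ (y ∸ x))
    (trans (cong (p ^_) (sym (ℕ.m∸n+n≡m x≤y))) (ℕ.^-distribˡ-+-* p (y ∸ x) x))

  m-last : m last ≡ p ^ b
  m-last = snoc-last (λ i → p ^ a i) (p ^ b)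

  m-inject₁ : ∀ i → m (inject₁ i) ≡ p ^ a i
  m-inject₁ = snoc-inject₁ (λ i → p ^ a i) (p ^ b)

  m-power : ∀ j → ∃ λ e → m j ≡ p ^ e
  m-power j = snoc a b j , snoc-map (p ^_) a b j

  m∣p^b : ∀ j → m j ∣ p ^ b
  m∣p^b j with last-or-inject₁ j
  ... | inj₁ refl       = subst (_∣ p ^ b) (sym m-last) ∣-refl
  ... | inj₂ (i , refl) = subst (_∣ p ^ b) (sym (m-inject₁ i)) (p^∣p^ (ℕ.<⇒≤ (a<b i)))

  exponent : IsExponent m (p ^ b)
  exponent = subst (IsExponent m) m-last
    (isExponent m last (subst (0 <_) (sym m-last) (0<p^ b)) (λ j → subst (m j ∣_) (sym m-last) (m∣p^b j)))

  ¬p∣⇒maxOrder : ∀ g → ¬ p ∣ g last → MaxOrder m g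
  ¬p∣⇒maxOrder g p∤g = p ^ b , exponent , 0<p^ b , proj₁ (proj₂ exponent) g ,
    λ n 0<n n<p^b n·g≡0 → ℕ.<⇒≱ n<p^b (∣⇒≤ {{ℕ.>-nonZero 0<n}}
      (p^n∣j*x⇒p^n∣j pp b p∤g (subst (_∣ n ℕ.* g last) m-last (n·g≡0 last))))

  -- p^(b-1) already kills g: the other factors have smaller exponents, and p ∣ g_last.
  p∣⇒¬maxOrder : ∀ g → p ∣ g last → ¬ MaxOrder m g
  p∣⇒¬maxOrder g p∣g (e , (0<e , e-annihilates , _) , (_ , _ , minimal)) =
    minimal (p ^ (b ∸ 1)) (0<p^ (b ∸ 1)) p^[b-1]<e p^[b-1]·g≡0
    where
      p^b≡p^[b-1]*p : p ^ b ≡ p ^ (b ∸ 1) ℕ.* p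
      p^b≡p^[b-1]*p = trans (cong (p ^_) (sym (ℕ.m∸n+n≡m 1≤b)))
                            (trans (ℕ.^-distribˡ-+-* p (b ∸ 1) 1) (cong (p ^ (b ∸ 1) ℕ.*_) (ℕ.*-identityʳ p)))
      p^[b-1]<e : p ^ (b ∸ 1) < e
      p^[b-1]<e = ℕ.<-≤-trans
        (subst (p ^ (b ∸ 1) <_) (sym p^b≡p^[b-1]*p) (ℕ.m<m*n (p ^ (b ∸ 1)) p {{ℕ.m^n≢0 p (b ∸ 1)}} (prime⇒2≤p pp)))
        (∣⇒≤ {{ℕ.>-nonZero 0<e}} (subst (_∣ e) m-last
          (annihilator⇒m[l]∣ m last e e-annihilates)))
      p^[b-1]·g≡0 : IsZero m ((p ^ (b ∸ 1)) · g)
      p^[b-1]·g≡0 j with last-or-inject₁ j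
      ... | inj₁ refl = subst (_∣ p ^ (b ∸ 1) ℕ.* g last) (sym (trans m-last p^b≡p^[b-1]*p))
                              (*-monoʳ-∣ (p ^ (b ∸ 1)) p∣g)
      ... | inj₂ (i , refl) = subst (_∣ p ^ (b ∸ 1) ℕ.* g (inject₁ i)) (sym (m-inject₁ i))
                                    (∣-trans (p^∣p^ (ℕ.suc[m]≤n⇒m≤pred[n] (a<b i))) (m∣m*n (g (inject₁ i))))

  weight : Elem k → Fin k → ℕ
  weight s j = if does (j ≟ last) ∧ does (p ∣? s last) then p else 1

  lastUnit lastMultiple : Elem k → Fin k → ℕ
  lastUnit     s j = if does (j ≟ last) ∧ not (does (p ∣? s last)) then 1 else 0
  lastMultiple s j = if does (j ≟ last) ∧ does (p ∣? s last) then 1 else 0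

  weight-power : ∀ s j → ∃ λ e → weight s j ≡ p ^ e
  weight-power s j with does (j ≟ last) ∧ does (p ∣? s last)
  ... | true  = 1 , sym (ℕ.*-identityʳ p)
  ... | false = 0 , refl

  weight∣ : ∀ s j → weight s j ∣ s j
  weight∣ s j with j ≟ last | p ∣? s last
  ... | yes refl | yes p∣s = p∣s
  ... | yes refl | no _    = 1∣ _
  ... | no _     | _       = 1∣ _

  weight≡ : ∀ s j → weight s j ≡ 1 ℕ.+ (p ∸ 1) ℕ.* lastMultiple s j
  weight≡ s j with j ≟ last | p ∣? s last
  ... | yes _ | yes _ = trans p≡1+[p∸1] (cong suc (sym (ℕ.*-identityʳ (p ∸ 1))))
  ... | yes _ | no _  = cong suc (sym (ℕ.*-zeroʳ (p ∸ 1)))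
  ... | no _  | _     = cong suc (sym (ℕ.*-zeroʳ (p ∸ 1)))

  single-last-weight : ∀ s j → single last (weight s j) j ≡ lastUnit s j ℕ.+ p ℕ.* lastMultiple s j
  single-last-weight s j with j ≟ last | p ∣? s last
  ... | yes _ | yes _ = sym (ℕ.*-identityʳ p)
  ... | yes _ | no _  = cong suc (sym (ℕ.*-zeroʳ p))
  ... | no _  | _     = sym (ℕ.*-zeroʳ p)

  lastUnit≤1 : ∀ s j → lastUnit s j ≤ 1
  lastUnit≤1 s j with does (j ≟ last) ∧ not (does (p ∣? s last))
  ... | true  = ℕ.≤-refl
  ... | false = z≤n

  lastUnit-¬max : ∀ s j → ¬ MaxOrder m s → lastUnit s j ≡ 0
  lastUnit-¬max s j ¬max with j ≟ last | p ∣? s last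
  ... | yes _ | yes _ = refl
  ... | yes _ | no p∤s = ⊥-elim (¬max (¬p∣⇒maxOrder s p∤s))
  ... | no _  | _      = refl

  open WeightedChoice pp m m-power weight weight-power weight∣

  tally : (Elem k → Fin k → ℕ) → ∀ S → Choice S → ℕ
  tally f []      []      = 0
  tally f (s ∷ S) (j ∷ c) = f s j ℕ.+ tally f S c

  length-expand : ∀ S c → length (expand S c) ≡ length S ℕ.+ (p ∸ 1) ℕ.* tally lastMultiple S c
  length-expand []      []      = sym (ℕ.*-zeroʳ (p ∸ 1))
  length-expand (s ∷ S) (j ∷ c) = begin
    length (replicate (weight s j) j ++ expand S c)
      ≡⟨ List.length-++ (replicate (weight s j) j) ⟩
    length (replicate (weight s j) j) ℕ.+ length (expand S c)
      ≡⟨ cong₂ ℕ._+_ (trans (List.length-replicate (weight s j)) (weight≡ s j)) (length-expand S c) ⟩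
    (1 ℕ.+ (p ∸ 1) ℕ.* lastMultiple s j) ℕ.+ (length S ℕ.+ (p ∸ 1) ℕ.* tally lastMultiple S c)
      ≡⟨ regroup (p ∸ 1) (lastMultiple s j) (length S) (tally lastMultiple S c) ⟩
    suc (length S) ℕ.+ (p ∸ 1) ℕ.* tally lastMultiple (s ∷ S) (j ∷ c) ∎
    where
      open ≡-Reasoning
      regroup : ∀ q y n Y → (1 ℕ.+ q ℕ.* y) ℕ.+ (n ℕ.+ q ℕ.* Y) ≡ suc n ℕ.+ q ℕ.* (y ℕ.+ Y)
      regroup = solve-∀

  count-last-expand : ∀ S c → count last (expand S c) ≡ tally lastUnit S c ℕ.+ p ℕ.* tally lastMultiple S c
  count-last-expand []      []      = sym (ℕ.*-zeroʳ p)
  count-last-expand (s ∷ S) (j ∷ c) = begin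
    count last (replicate (weight s j) j ++ expand S c)
      ≡⟨ count-++ last (replicate (weight s j) j) (expand S c) ⟩
    count last (replicate (weight s j) j) ℕ.+ count last (expand S c)
      ≡⟨ cong₂ ℕ._+_ (trans (count-replicate last j (weight s j)) (single-last-weight s j)) (count-last-expand S c) ⟩
    (lastUnit s j ℕ.+ p ℕ.* lastMultiple s j) ℕ.+ (tally lastUnit S c ℕ.+ p ℕ.* tally lastMultiple S c)
      ≡⟨ regroup p (lastUnit s j) (lastMultiple s j) (tally lastUnit S c) (tally lastMultiple S c) ⟩
    tally lastUnit (s ∷ S) (j ∷ c) ℕ.+ p ℕ.* tally lastMultiple (s ∷ S) (j ∷ c) ∎
    where
      open ≡-Reasoning
      regroup : ∀ p x y X Y → (x ℕ.+ p ℕ.* y) ℕ.+ (X ℕ.+ p ℕ.* Y) ≡ (x ℕ.+ X) ℕ.+ p ℕ.* (y ℕ.+ Y)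
      regroup = solve-∀

  tally-lastUnit≤countMax : ∀ S c n → CountMax m S n → tally lastUnit S c ≤ n
  tally-lastUnit≤countMax []      []      _ cnil = z≤n
  tally-lastUnit≤countMax (s ∷ S) (j ∷ c) _ (cyes _ counted) =
    ℕ.+-mono-≤ (lastUnit≤1 s j) (tally-lastUnit≤countMax S c _ counted)
  tally-lastUnit≤countMax (s ∷ S) (j ∷ c) n (cno ¬max counted)
    rewrite lastUnit-¬max s j ¬max = tally-lastUnit≤countMax S c n counted

  D N : ℕ
  D = sumFin r′ (λ i → p ^ a i ∸ 1)
  N = p ^ b ∸ 1

  admissible-length : ∀ ℓ → Admissible ℓ → length ℓ ≤ D ℕ.+ count last ℓ
  admissible-length ℓ adm = begin
    length ℓ                                                ≡⟨ length≡sumFin-count ℓ ⟩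
    sumFin k (λ j → count j ℓ)                              ≡⟨ sumFin-inject₁ r′ (λ j → count j ℓ) ⟩
    sumFin r′ (λ i → count (inject₁ i) ℓ) ℕ.+ count last ℓ  ≤⟨ ℕ.+-monoˡ-≤ (count last ℓ) (sumFin-mono r′ small) ⟩
    D ℕ.+ count last ℓ                                      ∎
    where
      open ℕ.≤-Reasoning
      small : ∀ i → count (inject₁ i) ℓ ≤ p ^ a i ∸ 1
      small i = ℕ.suc[m]≤n⇒m≤pred[n] (subst (count (inject₁ i) ℓ <_) (m-inject₁ i) (adm (inject₁ i)))

  zeroSumFree-structure : ∀ S → ZeroSumFree m S → ∃₂ λ X Y →
    length S ≤ D ℕ.+ (X ℕ.+ Y) × X ℕ.+ p ℕ.* Y ≤ N × (∀ n → CountMax m S n → X ≤ n)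
  zeroSumFree-structure S zsf with zeroSumFree⇒admissible S zsf
  ... | c , adm = X , Y , ℕ.+-cancelʳ-≤ ((p ∸ 1) ℕ.* Y) (length S) _ length-bound ,
                  subst (_≤ N) (count-last-expand S c) count-last≤N , tally-lastUnit≤countMax S c
    where
      X Y : ℕ
      X = tally lastUnit S c
      Y = tally lastMultiple S c
      count-last≤N : count last (expand S c) ≤ N
      count-last≤N = ℕ.suc[m]≤n⇒m≤pred[n] (subst (count last (expand S c) <_) m-last (adm last))
      length-bound : length S ℕ.+ (p ∸ 1) ℕ.* Y ≤ D ℕ.+ (X ℕ.+ Y) ℕ.+ (p ∸ 1) ℕ.* Y
      length-bound = begin
        length S ℕ.+ (p ∸ 1) ℕ.* Y            ≡⟨ length-expand S c ⟨
        length (expand S c)                   ≤⟨ admissible-length (expand S c) adm ⟩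
        D ℕ.+ count last (expand S c)         ≡⟨ cong (D ℕ.+_) (count-last-expand S c) ⟩
        D ℕ.+ (X ℕ.+ p ℕ.* Y)                 ≡⟨ cong (λ q → D ℕ.+ (X ℕ.+ q ℕ.* Y)) p≡1+[p∸1] ⟩
        D ℕ.+ (X ℕ.+ suc (p ∸ 1) ℕ.* Y)       ≡⟨ regroup D X Y (p ∸ 1) ⟩
        D ℕ.+ (X ℕ.+ Y) ℕ.+ (p ∸ 1) ℕ.* Y     ∎
        where
          open ℕ.≤-Reasoning
          regroup : ∀ D X Y q → D ℕ.+ (X ℕ.+ suc q ℕ.* Y) ≡ D ℕ.+ (X ℕ.+ Y) ℕ.+ q ℕ.* Y
          regroup = solve-∀

  extremal : ℕ → ℕ → List (Elem k)
  extremal X Y = blocks r′ (λ i → p ^ a i ∸ 1) (λ i → single (inject₁ i) 1)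
              ++ (replicate X (single last 1) ++ replicate Y (single last p))

  length-extremal : ∀ X Y → length (extremal X Y) ≡ D ℕ.+ (X ℕ.+ Y)
  length-extremal X Y = trans (List.length-++ (blocks r′ _ _)) (cong₂ ℕ._+_ (length-blocks r′ _ _)
    (trans (List.length-++ (replicate X (single last 1)))
           (cong₂ ℕ._+_ (List.length-replicate X) (List.length-replicate Y))))

  σ-extremal : ∀ X Y i → σ (extremal X Y) i
    ≡ sumFin r′ (λ j → (p ^ a j ∸ 1) ℕ.* single (inject₁ j) 1 i) ℕ.+ (X ℕ.* single last 1 i ℕ.+ Y ℕ.* single last p i)
  σ-extremal X Y i = trans (σ-++ (blocks r′ _ _) _ i) (cong₂ ℕ._+_ (σ-blocks r′ _ _ i)
    (trans (σ-++ (replicate X (single last 1)) _ i) (cong₂ ℕ._+_ (σ-replicate X _ i) (σ-replicate Y _ i))))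

  σ-extremal-last : ∀ X Y → σ (extremal X Y) last ≡ X ℕ.+ p ℕ.* Y
  σ-extremal-last X Y = begin
    σ (extremal X Y) last
      ≡⟨ σ-extremal X Y last ⟩
    sumFin r′ (λ j → (p ^ a j ∸ 1) ℕ.* single (inject₁ j) 1 last)
      ℕ.+ (X ℕ.* single last 1 last ℕ.+ Y ℕ.* single last p last)
      ≡⟨ cong₂ ℕ._+_ blocks≡0 (cong₂ (λ u v → X ℕ.* u ℕ.+ Y ℕ.* v) (single-diag last 1) (single-diag last p)) ⟩
    X ℕ.* 1 ℕ.+ Y ℕ.* p
      ≡⟨ cong₂ ℕ._+_ (ℕ.*-identityʳ X) (ℕ.*-comm Y p) ⟩
    X ℕ.+ p ℕ.* Y ∎
    where
      open ≡-Reasoning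
      blocks≡0 : sumFin r′ (λ j → (p ^ a j ∸ 1) ℕ.* single (inject₁ j) 1 last) ≡ 0
      blocks≡0 = trans (sumFin-cong r′ (λ j → trans (cong ((p ^ a j ∸ 1) ℕ.*_) (single-inject₁-last j 1))
                                                    (ℕ.*-zeroʳ (p ^ a j ∸ 1))))
                       (sumFin-zero r′)

  σ-extremal-inject₁ : ∀ X Y i → σ (extremal X Y) (inject₁ i) ≡ p ^ a i ∸ 1
  σ-extremal-inject₁ X Y i = begin
    σ (extremal X Y) (inject₁ i)
      ≡⟨ σ-extremal X Y (inject₁ i) ⟩
    sumFin r′ (λ j → (p ^ a j ∸ 1) ℕ.* single (inject₁ j) 1 (inject₁ i))
      ℕ.+ (X ℕ.* single last 1 (inject₁ i) ℕ.+ Y ℕ.* single last p (inject₁ i))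
      ≡⟨ cong₂ ℕ._+_ (sumFin-cong r′ λ j → trans (cong ((p ^ a j ∸ 1) ℕ.*_) (single-inject₁ j 1 i))
                                                 (single-scale (p ^ a j ∸ 1) j 1 i))
                     (cong₂ (λ u v → X ℕ.* u ℕ.+ Y ℕ.* v) (single-last-inject₁ 1 i) (single-last-inject₁ p i)) ⟩
    sumFin r′ (λ j → single j ((p ^ a j ∸ 1) ℕ.* 1) i) ℕ.+ (X ℕ.* 0 ℕ.+ Y ℕ.* 0)
      ≡⟨ cong₂ ℕ._+_ (sumFin-single r′ (λ j → (p ^ a j ∸ 1) ℕ.* 1) i)
                     (cong₂ ℕ._+_ (ℕ.*-zeroʳ X) (ℕ.*-zeroʳ Y)) ⟩
    (p ^ a i ∸ 1) ℕ.* 1 ℕ.+ 0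
      ≡⟨ trans (ℕ.+-identityʳ _) (ℕ.*-identityʳ _) ⟩
    p ^ a i ∸ 1 ∎
    where open ≡-Reasoning

  extremal-zeroSumFree : ∀ X Y → X ℕ.+ p ℕ.* Y ≤ N → ZeroSumFree m (extremal X Y)
  extremal-zeroSumFree X Y X+pY≤N = zeroSumFree-bounded m (extremal X Y) nonzero bounded
    where
      pred< : ∀ e → p ^ e ∸ 1 < p ^ e
      pred< e = ℕ.m≤pred[n]⇒suc[m]≤n {{ℕ.m^n≢0 p e}} ℕ.≤-refl
      bounded : ∀ i → σ (extremal X Y) i < m i
      bounded i with last-or-inject₁ i
      ... | inj₁ refl = subst₂ _<_ (sym (σ-extremal-last X Y)) (sym m-last) (ℕ.≤-<-trans X+pY≤N (pred< b))
      ... | inj₂ (i , refl) = subst₂ _<_ (sym (σ-extremal-inject₁ X Y i)) (sym (m-inject₁ i)) (pred< (a i))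
      nonzero : All NonZeroElem (extremal X Y)
      nonzero = ++⁺ (All-blocks r′ _ _ (λ j → inject₁ j , subst (0 <_) (sym (single-diag (inject₁ j) 1)) (s≤s z≤n)))
                    (++⁺ (replicate⁺ X (last , subst (0 <_) (sym (single-diag last 1)) (s≤s z≤n)))
                         (replicate⁺ Y (last , subst (0 <_) (sym (single-diag last p)) (ℕ.>-nonZero⁻¹ p))))

  extremal-countMax : ∀ X Y → CountMax m (extremal X Y) X
  extremal-countMax X Y = countMax-++ m
    (countMax-blocks-¬ m r′ _ _ (λ j → p∣⇒¬maxOrder _ (subst (p ∣_) (sym (single-inject₁-last j 1)) (p ∣0))))
    (subst (CountMax m _) (ℕ.+-identityʳ X)
      (countMax-++ m (countMax-replicate m X (¬p∣⇒maxOrder _ p∤1))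
                     (countMax-replicate-¬ m Y (p∣⇒¬maxOrder _ (subst (p ∣_) (sym (single-diag last p)) ∣-refl)))))
    where
      p∤1 : ¬ p ∣ single last 1 last
      p∤1 p∣1 = ℕ.<⇒≱ (prime⇒2≤p pp) (∣⇒≤ (subst (p ∣_) (single-diag last 1) p∣1))

  zeroSumFree-length≤D+N : ∀ S → ZeroSumFree m S → length S ≤ D ℕ.+ N
  zeroSumFree-length≤D+N S zsf =
    let X , Y , |S|≤D+X+Y , X+pY≤N , _ = zeroSumFree-structure S zsf in begin
      length S              ≤⟨ |S|≤D+X+Y ⟩
      D ℕ.+ (X ℕ.+ Y)       ≤⟨ ℕ.+-monoʳ-≤ D (ℕ.+-monoʳ-≤ X (ℕ.m≤n*m Y p)) ⟩
      D ℕ.+ (X ℕ.+ p ℕ.* Y) ≤⟨ ℕ.+-monoʳ-≤ D X+pY≤N ⟩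
      D ℕ.+ N               ∎
    where open ℕ.≤-Reasoning

  davenport : ∀ d → IsDavenport m d → d ≡ D ℕ.+ N
  davenport d ((S , zsf , |S|≡d) , maximal) = ℕ.≤-antisym
    (subst (_≤ D ℕ.+ N) |S|≡d (zeroSumFree-length≤D+N S zsf))
    (begin
      D ℕ.+ N               ≡⟨ cong (D ℕ.+_) (sym (ℕ.+-identityʳ N)) ⟩
      D ℕ.+ (N ℕ.+ 0)       ≡⟨ length-extremal N 0 ⟨
      length (extremal N 0) ≤⟨ maximal (extremal N 0) (extremal-zeroSumFree N 0 N+p0≤N) ⟩
      d                     ∎)
    where
      open ℕ.≤-Reasoning
      N+p0≤N : N ℕ.+ p ℕ.* 0 ≤ N
      N+p0≤N = ℕ.≤-reflexive (trans (cong (N ℕ.+_) (ℕ.*-zeroʳ p)) (ℕ.+-identityʳ N))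

N∸δ∸δ/q≤X : ∀ q .{{_ : NonZero q}} {N δ X Y} →
            N ≤ δ ℕ.+ (X ℕ.+ Y) → X ℕ.+ suc q ℕ.* Y ≤ N → N ∸ δ ∸ δ / q ≤ X
N∸δ∸δ/q≤X q {N} {δ} {X} {Y} N≤δ+X+Y X+[1+q]Y≤N =
  subst (_≤ X) (sym (ℕ.∸-+-assoc N δ (δ / q))) (ℕ.m≤n+o⇒m∸n≤o N (δ ℕ.+ δ / q) N≤δ+δ/q+X)
  where
    qY≤δ : q ℕ.* Y ≤ δ
    qY≤δ = ℕ.+-cancelˡ-≤ (X ℕ.+ Y) _ _ (begin
      X ℕ.+ Y ℕ.+ q ℕ.* Y  ≡⟨ ℕ.+-assoc X Y (q ℕ.* Y) ⟩
      X ℕ.+ suc q ℕ.* Y    ≤⟨ X+[1+q]Y≤N ⟩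
      N                    ≤⟨ N≤δ+X+Y ⟩
      δ ℕ.+ (X ℕ.+ Y)      ≡⟨ ℕ.+-comm δ (X ℕ.+ Y) ⟩
      X ℕ.+ Y ℕ.+ δ        ∎)
      where open ℕ.≤-Reasoning
    Y≤δ/q : Y ≤ δ / q
    Y≤δ/q = subst (_≤ δ / q) (m*n/n≡m Y q) (/-monoˡ-≤ q (subst (_≤ δ) (ℕ.*-comm q Y) qY≤δ))
    N≤δ+δ/q+X : N ≤ δ ℕ.+ δ / q ℕ.+ X
    N≤δ+δ/q+X = begin
      N                      ≤⟨ N≤δ+X+Y ⟩
      δ ℕ.+ (X ℕ.+ Y)        ≤⟨ ℕ.+-monoʳ-≤ δ (ℕ.+-monoʳ-≤ X Y≤δ/q) ⟩
      δ ℕ.+ (X ℕ.+ δ / q)    ≡⟨ regroup δ X (δ / q) ⟩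
      δ ℕ.+ δ / q ℕ.+ X      ∎
      where
        open ℕ.≤-Reasoning
        regroup : ∀ a b c → a ℕ.+ (b ℕ.+ c) ≡ a ℕ.+ c ℕ.+ b
        regroup = solve-∀

N∸δ-split : ∀ q .{{_ : NonZero q}} N δ →
  ∃ λ Y → N ∸ δ ∸ δ / q ℕ.+ Y ≡ N ∸ δ × N ∸ δ ∸ δ / q ℕ.+ suc q ℕ.* Y ≤ N
N∸δ-split q N δ = Y , X+Y≡N∸δ , X+[1+q]Y≤N
  where
    X Y : ℕ
    X = N ∸ δ ∸ δ / q
    Y = N ∸ δ ∸ X
    X+Y≡N∸δ : X ℕ.+ Y ≡ N ∸ δ
    X+Y≡N∸δ = ℕ.m+[n∸m]≡n (ℕ.m∸n≤m (N ∸ δ) (δ / q))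
    Y≤δ/q : Y ≤ δ / q
    Y≤δ/q = ℕ.m≤n+o⇒m∸n≤o (N ∸ δ) X (subst (N ∸ δ ≤_) (ℕ.+-comm (δ / q) X) (ℕ.m≤n+m∸n (N ∸ δ) (δ / q)))
    qY≤δ : q ℕ.* Y ≤ δ
    qY≤δ = ℕ.≤-trans (ℕ.*-monoʳ-≤ q Y≤δ/q) (subst (_≤ δ) (ℕ.*-comm (δ / q) q) (m/n*n≤m δ q))
    N∸δ+qY≤N : N ∸ δ ℕ.+ q ℕ.* Y ≤ N
    N∸δ+qY≤N with ℕ.≤-total δ N
    ... | inj₁ δ≤N = ℕ.≤-trans (ℕ.+-monoʳ-≤ (N ∸ δ) qY≤δ) (ℕ.≤-reflexive (ℕ.m∸n+n≡m δ≤N))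
    ... | inj₂ N≤δ = subst (λ z → z ℕ.+ q ℕ.* Y ≤ N) (sym N∸δ≡0)
                       (subst (λ y → q ℕ.* y ≤ N) (sym Y≡0) (subst (_≤ N) (sym (ℕ.*-zeroʳ q)) z≤n))
      where
        N∸δ≡0 : N ∸ δ ≡ 0
        N∸δ≡0 = ℕ.m≤n⇒m∸n≡0 N≤δ
        Y≡0 : Y ≡ 0
        Y≡0 = ℕ.n≤0⇒n≡0 (subst (Y ≤_) N∸δ≡0 (ℕ.m∸n≤m (N ∸ δ) X))
    X+[1+q]Y≤N : X ℕ.+ suc q ℕ.* Y ≤ N
    X+[1+q]Y≤N = begin
      X ℕ.+ suc q ℕ.* Y      ≡⟨ ℕ.+-assoc X Y (q ℕ.* Y) ⟨
      X ℕ.+ Y ℕ.+ q ℕ.* Y    ≡⟨ cong (ℕ._+ q ℕ.* Y) X+Y≡N∸δ ⟩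
      N ∸ δ ℕ.+ q ℕ.* Y      ≤⟨ N∸δ+qY≤N ⟩
      N                      ∎
      where open ℕ.≤-Reasoning

[m+n]∸o≤m+[n∸o] : ∀ m n o → m ℕ.+ n ∸ o ≤ m ℕ.+ (n ∸ o)
[m+n]∸o≤m+[n∸o] m n o = ℕ.m≤n+o⇒m∸n≤o (m ℕ.+ n) o (begin
  m ℕ.+ n                  ≤⟨ ℕ.+-monoʳ-≤ m (ℕ.m≤n+m∸n n o) ⟩
  m ℕ.+ (o ℕ.+ (n ∸ o))    ≡⟨ ℕ.+-comm m _ ⟩
  o ℕ.+ (n ∸ o) ℕ.+ m      ≡⟨ ℕ.+-assoc o (n ∸ o) m ⟩
  o ℕ.+ ((n ∸ o) ℕ.+ m)    ≡⟨ cong (o ℕ.+_) (ℕ.+-comm (n ∸ o) m) ⟩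
  o ℕ.+ (m ℕ.+ (n ∸ o))    ∎)
  where open ℕ.≤-Reasoning

[m+n]∸o≤m+z⇒n≤o+z : ∀ m n o z → m ℕ.+ n ∸ o ≤ m ℕ.+ z → n ≤ o ℕ.+ z
[m+n]∸o≤m+z⇒n≤o+z m n o z [m+n]∸o≤m+z = ℕ.+-cancelˡ-≤ m n (o ℕ.+ z) (begin
  m ℕ.+ n                  ≤⟨ ℕ.m≤n+m∸n (m ℕ.+ n) o ⟩
  o ℕ.+ (m ℕ.+ n ∸ o)      ≤⟨ ℕ.+-monoʳ-≤ o [m+n]∸o≤m+z ⟩
  o ℕ.+ (m ℕ.+ z)          ≡⟨ swap o m z ⟩
  m ℕ.+ (o ℕ.+ z)          ∎)
  where
    open ℕ.≤-Reasoning
    swap : ∀ a b c → a ℕ.+ (b ℕ.+ c) ≡ b ℕ.+ (a ℕ.+ c)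
    swap = solve-∀

theorem2p6 : (p r' : ℕ) (a : Fin r' → ℕ) (b : ℕ) → Prime p → .{{_ : NonZero (p ∸ 1)}} →
    (∀ i → 1 ≤ a i) → (∀ i j → i ≤ᶠ j → a i ≤ a j) → (∀ i → a i < b) → 1 ≤ b →
    (d : ℕ) → IsDavenport (snoc (λ i → p ^ a i) (p ^ b)) d →
    (δ : ℕ) → δ < d →
    IsGamma (snoc (λ i → p ^ a i) (p ^ b)) d δ (((p ^ b) ∸ 1) ∸ δ ∸ (δ / (p ∸ 1)))
theorem2p6 p _ a _ pp _ _ a<b 1≤b d isDavenport δ _ = attained , minimal
  where
    open PrimePowerGroup pp a a<b 1≤b
    d≡D+N : d ≡ D ℕ.+ N
    d≡D+N = davenport d isDavenport
    p*≡ : ∀ Y → p ℕ.* Y ≡ suc (p ∸ 1) ℕ.* Y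
    p*≡ Y = cong (ℕ._* Y) p≡1+[p∸1]

    attained : Σ (List (Elem k)) λ S → ZeroSumFree m S × d ∸ δ ≤ length S × CountMax m S (N ∸ δ ∸ δ / (p ∸ 1))
    attained with N∸δ-split (p ∸ 1) N δ
    ... | Y , X+Y≡N∸δ , X+pY≤N =
      extremal X Y ,
      extremal-zeroSumFree X Y (subst (λ z → X ℕ.+ z ≤ N) (sym (p*≡ Y)) X+pY≤N) ,
      subst₂ _≤_ (cong (_∸ δ) (sym d≡D+N)) (sym (trans (length-extremal X Y) (cong (D ℕ.+_) X+Y≡N∸δ)))
             ([m+n]∸o≤m+[n∸o] D N δ) ,
      extremal-countMax X Y
      where X = N ∸ δ ∸ δ / (p ∸ 1)

    minimal : ∀ S c → ZeroSumFree m S → d ∸ δ ≤ length S → CountMax m S c → N ∸ δ ∸ δ / (p ∸ 1) ≤ c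
    minimal S c zsf d∸δ≤|S| counted =
      let X , Y , |S|≤D+X+Y , X+pY≤N , X≤countMax = zeroSumFree-structure S zsf
          N≤δ+X+Y = [m+n]∸o≤m+z⇒n≤o+z D N δ (X ℕ.+ Y)
                      (subst (λ e → e ∸ δ ≤ D ℕ.+ (X ℕ.+ Y)) d≡D+N (ℕ.≤-trans d∸δ≤|S| |S|≤D+X+Y))
      in ℕ.≤-trans (N∸δ∸δ/q≤X (p ∸ 1) N≤δ+X+Y (subst (λ z → X ℕ.+ z ≤ N) (p*≡ Y) X+pY≤N))
                   (X≤countMax c counted)
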